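{- Let $\delta$ be a probability distribution over permutations of an $n$-element set $U$, let $1\le k\le n/r$, and let $S_1,\dots,S_k\subseteq U$ be pairwise disjoint sets with $|S_j|=r$ for all $j$. Let $\mathcal{E}_j=\mathbb{E}_{\pi\sim\delta}[\pi(S_j)]$. If $\mathcal{E}_1\le\dots\le\mathcal{E}_k$, then $\mathcal{E}_j\ge\frac{j+1}{2}$ for all $1\le j\le k$.
   Context: For a permutation $\pi$ of $U$ giving each element $e$ a position $\pi[e]\in\{1,\dots,n\}$ and nonempty $S\subseteq U$, $\pi(S)=\min_{e\in S}\pi[e]$.
   Formalization: The probability distribution δ over permutations of U assigns a rational probability to each permutation. -}

module Defs where

open import Data.Nat as ℕ using (ℕ; suc; _⊓_)
open import Data.Bool using (Bool; true; false; if_then_else_)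
open import Data.Fin using (Fin; toℕ)
open import Data.Fin.Subset using (Subset)
open import Data.Fin.Permutation using (Permutation′; _⟨$⟩ʳ_)
open import Data.List using (List; foldr; allFin; map)
open import Data.Product using (_×_; _,_; proj₁; proj₂)
open import Data.Integer using (+_)
open import Data.Rational using (ℚ; 0ℚ; 1ℚ; _+_; _*_; _≤_; _/_)
open import Data.Vec using (lookup)
open import Data.List.Relation.Unary.All using (All)
open import Relation.Binary.PropositionalEquality using (_≡_)

-- Position of element e under π, in {1,…,n}:  π[e] = 1 + (π e as a Fin index)
pos : ∀ {n} → Permutation′ n → Fin n → ℕ
pos π e = suc (toℕ (π ⟨$⟩ʳ e))

-- π(S) = min_{e ∈ S} π[e].  The fold starts at n, which is ≥ every position,
-- so for nonempty S this is exactly the minimum over S.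
minPos : ∀ {n} → Permutation′ n → Subset n → ℕ
minPos {n} π S =
  foldr (λ e acc → if lookup S e then pos π e ⊓ acc else acc) n (allFin n)

Dist : ℕ → Set
Dist n = List (ℚ × Permutation′ n)

totalWeight : ∀ {n} → Dist n → ℚ
totalWeight = foldr (λ p acc → proj₁ p + acc) 0ℚ

IsProbDist : ∀ {n} → Dist n → Set
IsProbDist δ = All (λ p → 0ℚ ≤ proj₁ p) δ × (totalWeight δ ≡ 1ℚ)

expect : ∀ {n} → Dist n → (Permutation′ n → ℕ) → ℚ
expect δ f = foldr (λ p acc → proj₁ p * ((+ f (proj₂ p)) / 1) + acc) 0ℚ δ

{-# OPTIONS --safe #-}
module Submission where

-- For every permutation π the minima π(S₀), …, π(Sₜ) of disjoint nonempty sets are positions of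
-- distinct elements, hence m = t + 1 distinct positive integers, so they sum to at least
-- 1 + ⋯ + m = m(m + 1)/2.  Taking expectations, E₀ + ⋯ + Eₜ ≥ m(m + 1)/2, and as every Eᵢ is at
-- most Eₜ, m·Eₜ ≥ m(m + 1)/2.

open import Defs
open import Data.Bool using (true; false; if_then_else_)
open import Data.Fin using (Fin; zero; suc; toℕ; punchIn; fromℕ<; inject≤; _≟_)
import Data.Fin.Properties as Fin
open import Data.Fin.Permutation using (Permutation′; _⟨$⟩ʳ_)
open import Data.Fin.Subset using (Subset; ∣_∣; _∩_; ⊥; _∈_; Nonempty)
open import Data.Fin.Subset.Properties using (x∈p∩q⁺; ∉⊥; nonempty?; Empty-unique; ∣⊥∣≡0)
open import Data.Integer using (+_)
import Data.Integer as ℤ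
import Data.Integer.Properties as ℤ
open import Data.List using ([]; _∷_; foldr; allFin)
open import Data.List.Membership.Propositional.Properties using (∈-allFin)
import Data.List.Membership.Propositional as List
open import Data.List.Relation.Unary.All using (All; []; _∷_)
open import Data.List.Relation.Unary.Any using (here; there)
open import Data.Nat as ℕ using (ℕ; zero; suc; _*_)
open import Data.Nat.Coprimality using (1-coprimeTo)
import Data.Nat.Coprimality as Coprime
import Data.Nat.Properties as ℕ
open import Data.Nat.Solver using () renaming (module +-*-Solver to ℕ-Solver)
open import Data.Product using (_×_; _,_; proj₁; proj₂; ∃)
open import Data.Rational using (ℚ; 0ℚ; 1ℚ; _≤_; _/_; toℚᵘ)
import Data.Rational as ℚ
open import Data.Rational.Properties
  using ( normalize-coprime; normalize-pos; toℚᵘ-injective; toℚᵘ-cancel-≤; toℚᵘ-fromℚᵘ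
        ; toℚᵘ-homo-+; toℚᵘ-homo-*; *-identityˡ; *-identityʳ; *-zeroˡ; *-zeroʳ; *-distribʳ-+
        ; ≤-refl; ≤-reflexive; +-mono-≤; *-monoˡ-≤-nonNeg; *-cancelˡ-≤-pos; module ≤-Reasoning )
open import Data.Rational.Solver using () renaming (module +-*-Solver to ℚ-Solver)
open import Data.Rational.Unnormalised as ℚᵘ using (mkℚᵘ; *≡*; *≤*)
import Data.Rational.Unnormalised.Properties as ℚᵘ
open import Data.Sum using (_⊎_; inj₁; inj₂)
open import Data.Vec using (lookup)
open import Data.Vec.Properties using ([]=⇒lookup; lookup⇒[]=)
open import Function using (_∘_)
open import Function.Bundles using (Injection)
open import Function.Definitions using (Injective)
open import Function.Properties.Inverse using (↔⇒↣)
open import Relation.Binary.PropositionalEquality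
  using (_≡_; _≢_; refl; sym; trans; cong; cong₂; subst; subst₂; module ≡-Reasoning)
open import Relation.Nullary using (yes; no; contradiction)

open import Algebra.Properties.CommutativeMonoid.Sum ℕ.+-0-commutativeMonoid
  using (sum; sum-remove; sum-cong-≗)
open import Algebra.Properties.CommutativeSemigroup ℕ.+-commutativeSemigroup using (x∙yz≈y∙xz)

-- `expect` coerces values by this very term, so lemmas about fromℕ apply to it definitionally.
fromℕ : ℕ → ℚ
fromℕ a = + a / 1

toℚᵘ-fromℕ : ∀ a → toℚᵘ (fromℕ a) ≡ mkℚᵘ (+ a) 0
toℚᵘ-fromℕ a = cong toℚᵘ (normalize-coprime (Coprime.sym (1-coprimeTo a)))

fromℕ-mono-≤ : ∀ {a b} → a ℕ.≤ b → fromℕ a ≤ fromℕ b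
fromℕ-mono-≤ {a} {b} a≤b = toℚᵘ-cancel-≤
  (subst₂ ℚᵘ._≤_ (sym (toℚᵘ-fromℕ a)) (sym (toℚᵘ-fromℕ b))
    (*≤* (subst₂ ℤ._≤_ (sym (ℤ.*-identityʳ (+ a))) (sym (ℤ.*-identityʳ (+ b))) (ℤ.+≤+ a≤b))))

fromℕ-+ : ∀ a b → fromℕ (a ℕ.+ b) ≡ fromℕ a ℚ.+ fromℕ b
fromℕ-+ a b = toℚᵘ-injective (begin
  toℚᵘ (fromℕ (a ℕ.+ b))                ≡⟨ toℚᵘ-fromℕ (a ℕ.+ b) ⟩
  mkℚᵘ (+ (a ℕ.+ b)) 0                  ≈⟨ *≡* (cong (ℤ._* + 1) numerators) ⟩
  mkℚᵘ (+ a) 0 ℚᵘ.+ mkℚᵘ (+ b) 0        ≡⟨ cong₂ ℚᵘ._+_ (toℚᵘ-fromℕ a) (toℚᵘ-fromℕ b) ⟨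
  toℚᵘ (fromℕ a) ℚᵘ.+ toℚᵘ (fromℕ b)    ≈⟨ toℚᵘ-homo-+ (fromℕ a) (fromℕ b) ⟨
  toℚᵘ (fromℕ a ℚ.+ fromℕ b)            ∎)
  where
  open ℚᵘ.≃-Reasoning
  numerators : + (a ℕ.+ b) ≡ + a ℤ.* + 1 ℤ.+ + b ℤ.* + 1
  numerators = trans (ℤ.pos-+ a b) (sym (cong₂ ℤ._+_ (ℤ.*-identityʳ (+ a)) (ℤ.*-identityʳ (+ b))))

fromℕ-suc-* : ∀ m x → fromℕ (suc m) ℚ.* x ≡ x ℚ.+ fromℕ m ℚ.* x
fromℕ-suc-* m x = begin
  fromℕ (suc m) ℚ.* x           ≡⟨ cong (ℚ._* x) (fromℕ-+ 1 m) ⟩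
  (1ℚ ℚ.+ fromℕ m) ℚ.* x        ≡⟨ *-distribʳ-+ x 1ℚ (fromℕ m) ⟩
  1ℚ ℚ.* x ℚ.+ fromℕ m ℚ.* x    ≡⟨ cong (ℚ._+ fromℕ m ℚ.* x) (*-identityˡ x) ⟩
  x ℚ.+ fromℕ m ℚ.* x           ∎
  where
  open ≡-Reasoning

[a/1]*[c/d]≃b/1 : ∀ a b c d → a * c ≡ b * suc d → mkℚᵘ (+ a) 0 ℚᵘ.* mkℚᵘ (+ c) d ℚᵘ.≃ mkℚᵘ (+ b) 0
[a/1]*[c/d]≃b/1 a b c d ac≡bd = *≡* (begin
  (+ a ℤ.* + c) ℤ.* + 1   ≡⟨ ℤ.*-identityʳ (+ a ℤ.* + c) ⟩
  + a ℤ.* + c             ≡⟨ ℤ.pos-* a c ⟨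
  + (a * c)               ≡⟨ cong +_ (trans ac≡bd (cong (b *_) (sym (ℕ.*-identityˡ (suc d))))) ⟩
  + (b * (1 * suc d))     ≡⟨ ℤ.pos-* b (1 * suc d) ⟩
  + b ℤ.* + (1 * suc d)   ∎)
  where
  open ≡-Reasoning

fromℕ-*-/ : ∀ a b c d → a * c ≡ b * suc d → fromℕ a ℚ.* (+ c / suc d) ≡ fromℕ b
fromℕ-*-/ a b c d ac≡bd = toℚᵘ-injective (begin
  toℚᵘ (fromℕ a ℚ.* (+ c / suc d))          ≈⟨ toℚᵘ-homo-* (fromℕ a) (+ c / suc d) ⟩
  toℚᵘ (fromℕ a) ℚᵘ.* toℚᵘ (+ c / suc d)    ≈⟨ ℚᵘ.*-cong (ℚᵘ.≃-reflexive (toℚᵘ-fromℕ a))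
                                                          (toℚᵘ-fromℚᵘ (mkℚᵘ (+ c) d)) ⟩
  mkℚᵘ (+ a) 0 ℚᵘ.* mkℚᵘ (+ c) d            ≈⟨ [a/1]*[c/d]≃b/1 a b c d ac≡bd ⟩
  mkℚᵘ (+ b) 0                              ≡⟨ toℚᵘ-fromℕ b ⟨
  toℚᵘ (fromℕ b)                            ∎)
  where
  open ℚᵘ.≃-Reasoning

module _ {n : ℕ} where

  expect-+ : ∀ (δ : Dist n) f g → expect δ (λ π → f π ℕ.+ g π) ≡ expect δ f ℚ.+ expect δ g
  expect-+ [] f g = refl
  expect-+ ((w , π) ∷ δ) f g = begin
    w ℚ.* fromℕ (f π ℕ.+ g π) ℚ.+ expect δ (λ σ → f σ ℕ.+ g σ)
      ≡⟨ cong₂ (λ a b → w ℚ.* a ℚ.+ b) (fromℕ-+ (f π) (g π)) (expect-+ δ f g) ⟩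
    w ℚ.* (fromℕ (f π) ℚ.+ fromℕ (g π)) ℚ.+ (expect δ f ℚ.+ expect δ g)
      ≡⟨ solve 5 (λ w a b x y → w :* (a :+ b) :+ (x :+ y) := (w :* a :+ x) :+ (w :* b :+ y))
           refl w (fromℕ (f π)) (fromℕ (g π)) (expect δ f) (expect δ g) ⟩
    (w ℚ.* fromℕ (f π) ℚ.+ expect δ f) ℚ.+ (w ℚ.* fromℕ (g π) ℚ.+ expect δ g) ∎
    where
    open ≡-Reasoning
    open ℚ-Solver

  expect-const : ∀ (δ : Dist n) c → expect δ (λ _ → c) ≡ fromℕ c ℚ.* totalWeight δ
  expect-const [] c = sym (*-zeroʳ (fromℕ c))
  expect-const ((w , π) ∷ δ) c = begin
    w ℚ.* fromℕ c ℚ.+ expect δ (λ _ → c)          ≡⟨ cong (w ℚ.* fromℕ c ℚ.+_) (expect-const δ c) ⟩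
    w ℚ.* fromℕ c ℚ.+ fromℕ c ℚ.* totalWeight δ   ≡⟨ solve 3 (λ w a t → w :* a :+ a :* t := a :* (w :+ t))
                                                        refl w (fromℕ c) (totalWeight δ) ⟩
    fromℕ c ℚ.* (w ℚ.+ totalWeight δ)             ∎
    where
    open ≡-Reasoning
    open ℚ-Solver

  IsProbDist⇒expect-const : ∀ {δ : Dist n} → IsProbDist δ → ∀ c → expect δ (λ _ → c) ≡ fromℕ c
  IsProbDist⇒expect-const {δ} (_ , total≡1) c = begin
    expect δ (λ _ → c)          ≡⟨ expect-const δ c ⟩
    fromℕ c ℚ.* totalWeight δ   ≡⟨ cong (fromℕ c ℚ.*_) total≡1 ⟩
    fromℕ c ℚ.* 1ℚ              ≡⟨ *-identityʳ (fromℕ c) ⟩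
    fromℕ c                     ∎
    where
    open ≡-Reasoning

  expect-mono-≤ : ∀ {δ : Dist n} → All (λ p → 0ℚ ≤ proj₁ p) δ → ∀ {f g} →
                  (∀ π → f π ℕ.≤ g π) → expect δ f ≤ expect δ g
  expect-mono-≤ [] f≤g = ≤-refl
  expect-mono-≤ {(w , π) ∷ δ} (0≤w ∷ nonNeg) f≤g =
    +-mono-≤ (*-monoˡ-≤-nonNeg w {{ℚ.nonNegative 0≤w}} (fromℕ-mono-≤ (f≤g π))) (expect-mono-≤ nonNeg f≤g)

  expect-sum-≤ : ∀ (δ : Dist n) {m} (g : Fin m → Permutation′ n → ℕ) x →
                 (∀ i → expect δ (g i) ≤ x) → expect δ (λ π → sum (λ i → g i π)) ≤ fromℕ m ℚ.* x
  expect-sum-≤ δ {zero} g x _ = ≤-reflexive (begin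
    expect δ (λ _ → 0)     ≡⟨ expect-const δ 0 ⟩
    0ℚ ℚ.* totalWeight δ   ≡⟨ *-zeroˡ (totalWeight δ) ⟩
    0ℚ                     ≡⟨ *-zeroˡ x ⟨
    0ℚ ℚ.* x               ∎)
    where
    open ≡-Reasoning
  expect-sum-≤ δ {suc m} g x g≤x = begin
    expect δ (λ π → g zero π ℕ.+ sum (λ i → g (suc i) π))
      ≡⟨ expect-+ δ (g zero) _ ⟩
    expect δ (g zero) ℚ.+ expect δ (λ π → sum (λ i → g (suc i) π))
      ≤⟨ +-mono-≤ (g≤x zero) (expect-sum-≤ δ (g ∘ suc) x (g≤x ∘ suc)) ⟩
    x ℚ.+ fromℕ m ℚ.* x
      ≡⟨ fromℕ-suc-* m x ⟨
    fromℕ (suc m) ℚ.* x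
      ∎
    where
    open ≤-Reasoning

tri : ℕ → ℕ
tri zero    = 0
tri (suc m) = m ℕ.+ tri m

tri[1+m]*2≡m*[1+m] : ∀ m → tri (suc m) * 2 ≡ m * suc m
tri[1+m]*2≡m*[1+m] zero    = refl
tri[1+m]*2≡m*[1+m] (suc m) = begin
  (suc m ℕ.+ tri (suc m)) * 2     ≡⟨ ℕ.*-distribʳ-+ 2 (suc m) (tri (suc m)) ⟩
  suc m * 2 ℕ.+ tri (suc m) * 2   ≡⟨ cong (suc m * 2 ℕ.+_) (tri[1+m]*2≡m*[1+m] m) ⟩
  suc m * 2 ℕ.+ m * suc m         ≡⟨ solve 1 (λ m → (con 1 :+ m) :* con 2 :+ m :* (con 1 :+ m)
                                                   := (con 1 :+ m) :* (con 2 :+ m)) refl m ⟩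
  suc m * suc (suc m)             ∎
  where
  open ≡-Reasoning
  open ℕ-Solver

sum-suc : ∀ {m} (h : Fin m → ℕ) → sum (λ i → suc (h i)) ≡ m ℕ.+ sum h
sum-suc {zero}  h = refl
sum-suc {suc m} h = cong suc (begin
  h zero ℕ.+ sum (λ i → suc (h (suc i)))   ≡⟨ cong (h zero ℕ.+_) (sum-suc (h ∘ suc)) ⟩
  h zero ℕ.+ (m ℕ.+ sum (h ∘ suc))         ≡⟨ x∙yz≈y∙xz (h zero) m (sum (h ∘ suc)) ⟩
  m ℕ.+ (h zero ℕ.+ sum (h ∘ suc))         ∎)
  where
  open ≡-Reasoning

injective⇒∃≥ : ∀ {m} (h : Fin (suc m) → ℕ) → Injective _≡_ _≡_ h → ∃ λ p → m ℕ.≤ h p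
injective⇒∃≥ {m} h h-inj with Fin.any? (λ i → m ℕ.≤? h i)
... | yes found = found
... | no ¬found = contradiction (Fin.injective⇒≤ f-inj) (ℕ.n≮n m)
  where
  h<m : ∀ i → h i ℕ.< m
  h<m i = ℕ.≰⇒> (λ m≤hi → ¬found (i , m≤hi))
  f : Fin (suc m) → Fin m
  f i = fromℕ< (h<m i)
  f-inj : Injective _≡_ _≡_ f
  f-inj {i} {j} fi≡fj =
    h-inj (trans (sym (Fin.toℕ-fromℕ< (h<m i))) (trans (cong toℕ fi≡fj) (Fin.toℕ-fromℕ< (h<m j))))

tri≤sum-injective : ∀ {m} (h : Fin m → ℕ) → Injective _≡_ _≡_ h → tri m ℕ.≤ sum h
tri≤sum-injective {zero}  h h-inj = ℕ.z≤n
tri≤sum-injective {suc m} h h-inj with injective⇒∃≥ h h-inj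
... | p , m≤hp = begin
  m ℕ.+ tri m                     ≤⟨ ℕ.+-mono-≤ m≤hp (tri≤sum-injective (h ∘ punchIn p) h∘punchIn-inj) ⟩
  h p ℕ.+ sum (h ∘ punchIn p)     ≡⟨ sum-remove h ⟨
  sum h                           ∎
  where
  open ℕ.≤-Reasoning
  h∘punchIn-inj : Injective _≡_ _≡_ (h ∘ punchIn p)
  h∘punchIn-inj = Fin.punchIn-injective p _ _ ∘ h-inj

module _ {n : ℕ} (π : Permutation′ n) (S : Subset n) where

  private
    keepMin : Fin n → ℕ → ℕ
    keepMin e acc = if lookup S e then pos π e ℕ.⊓ acc else acc

    foldr-keepMin-≤ : ∀ {b} xs {e} → e List.∈ xs → e ∈ S → foldr keepMin b xs ℕ.≤ pos π e
    foldr-keepMin-≤ (x ∷ xs) (here refl) x∈S rewrite []=⇒lookup x∈S = ℕ.m⊓n≤m (pos π x) _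
    foldr-keepMin-≤ (x ∷ xs) (there e∈xs) e∈S with lookup S x
    ... | false = foldr-keepMin-≤ xs e∈xs e∈S
    ... | true  = ℕ.≤-trans (ℕ.m⊓n≤n (pos π x) _) (foldr-keepMin-≤ xs e∈xs e∈S)

    foldr-keepMin-sel : ∀ {b} xs → foldr keepMin b xs ≡ b ⊎ ∃ λ e → e ∈ S × foldr keepMin b xs ≡ pos π e
    foldr-keepMin-sel []       = inj₁ refl
    foldr-keepMin-sel (x ∷ xs) with lookup S x in x∈S
    ... | false = foldr-keepMin-sel xs
    ... | true with ℕ.⊓-sel (pos π x) (foldr keepMin _ xs)
    ...   | inj₁ min≡x    = inj₂ (x , lookup⇒[]= x S x∈S , min≡x)
    ...   | inj₂ min≡rest rewrite min≡rest = foldr-keepMin-sel xs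

  minPos-≤ : ∀ {e} → e ∈ S → minPos π S ℕ.≤ pos π e
  minPos-≤ {e} = foldr-keepMin-≤ (allFin n) (∈-allFin e)

  minPos-attained : Nonempty S → ∃ λ e → e ∈ S × minPos π S ≡ pos π e
  minPos-attained (e , e∈S) with foldr-keepMin-sel (allFin n)
  ... | inj₂ attained = attained
  ... | inj₁ min≡n    = e , e∈S , ℕ.≤-antisym (minPos-≤ e∈S)
          (subst (pos π e ℕ.≤_) (sym min≡n) (Fin.toℕ<n (π ⟨$⟩ʳ e)))

0<∣p∣⇒Nonempty : ∀ {n} (p : Subset n) → 0 ℕ.< ∣ p ∣ → Nonempty p
0<∣p∣⇒Nonempty {n} p 0<∣p∣ with nonempty? p
... | yes p≢∅ = p≢∅
... | no  p≡∅ = contradiction (trans (cong ∣_∣ (Empty-unique p≡∅)) (∣⊥∣≡0 n)) (ℕ.>⇒≢ 0<∣p∣)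

PairwiseDisjoint : ∀ {m n} → (Fin m → Subset n) → Set
PairwiseDisjoint S = ∀ i j → i ≢ j → S i ∩ S j ≡ ⊥

PairwiseDisjoint-∘ : ∀ {k m n} {S : Fin k → Subset n} {ι : Fin m → Fin k} →
                     Injective _≡_ _≡_ ι → PairwiseDisjoint S → PairwiseDisjoint (S ∘ ι)
PairwiseDisjoint-∘ {ι = ι} ι-inj disjoint i j i≢j = disjoint (ι i) (ι j) (i≢j ∘ ι-inj)

PairwiseDisjoint⇒∈-unique : ∀ {m n} {S : Fin m → Subset n} → PairwiseDisjoint S →
                            ∀ {x i j} → x ∈ S i → x ∈ S j → i ≡ j
PairwiseDisjoint⇒∈-unique disjoint {x} {i} {j} x∈Si x∈Sj with i ≟ j
... | yes i≡j = i≡j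
... | no  i≢j = contradiction (subst (x ∈_) (disjoint i j i≢j) (x∈p∩q⁺ (x∈Si , x∈Sj))) ∉⊥

tri≤sum-minPos : ∀ {m n} (π : Permutation′ n) (S : Fin m → Subset n) →
                 (∀ i → Nonempty (S i)) → PairwiseDisjoint S →
                 tri (suc m) ℕ.≤ sum (λ i → minPos π (S i))
tri≤sum-minPos {m} {n} π S nonempty disjoint = begin
  m ℕ.+ tri m                  ≤⟨ ℕ.+-monoʳ-≤ m (tri≤sum-injective rank rank-injective) ⟩
  m ℕ.+ sum rank               ≡⟨ sum-suc rank ⟨
  sum (suc ∘ rank)             ≡⟨ sum-cong-≗ (sym ∘ minPos≡) ⟩
  sum (λ i → minPos π (S i))   ∎
  where
  open ℕ.≤-Reasoning
  argmin : ∀ i → ∃ λ e → e ∈ S i × minPos π (S i) ≡ pos π e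
  argmin i = minPos-attained π (S i) (nonempty i)
  e : Fin m → Fin n
  e = proj₁ ∘ argmin
  e∈S : ∀ i → e i ∈ S i
  e∈S = proj₁ ∘ proj₂ ∘ argmin
  minPos≡ : ∀ i → minPos π (S i) ≡ pos π (e i)
  minPos≡ = proj₂ ∘ proj₂ ∘ argmin
  rank : Fin m → ℕ
  rank i = toℕ (π ⟨$⟩ʳ e i)
  rank-injective : Injective _≡_ _≡_ rank
  rank-injective {i} {j} rank≡ = PairwiseDisjoint⇒∈-unique disjoint (e∈S i)
    (subst (_∈ S j) (sym (Injection.injective (↔⇒↣ π) (Fin.toℕ-injective rank≡))) (e∈S j))

lemma7 : (n r k : ℕ) (δ : Dist n) → IsProbDist δ
    → 1 ℕ.≤ k → k * r ℕ.≤ n → 1 ℕ.≤ r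
    → (S : Fin k → Subset n)
    → (∀ i j → i ≢ j → S i ∩ S j ≡ ⊥)
    → (∀ j → ∣ S j ∣ ≡ r)
    → (∀ i j → toℕ i ℕ.≤ toℕ j → expect δ (λ π → minPos π (S i)) ≤ expect δ (λ π → minPos π (S j)))
    → ∀ j → (+ (toℕ j ℕ.+ 2)) / 2 ≤ expect δ (λ π → minPos π (S j))
lemma7 n r k δ prob@(nonNeg , _) _ _ 1≤r S disjoint ∣S∣≡r ordered j =
  *-cancelˡ-≤-pos (fromℕ m) {{normalize-pos m 1}} (begin
    fromℕ m ℚ.* (+ (t ℕ.+ 2) / 2)
      ≡⟨ fromℕ-*-/ m (tri (suc m)) (t ℕ.+ 2) 1 gauss ⟩
    fromℕ (tri (suc m))
      ≡⟨ IsProbDist⇒expect-const prob (tri (suc m)) ⟨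
    expect δ (λ _ → tri (suc m))
      ≤⟨ expect-mono-≤ nonNeg (λ π → tri≤sum-minPos π Sᵢ nonempty disjointᵢ) ⟩
    expect δ (λ π → sum (λ i → minPos π (Sᵢ i)))
      ≤⟨ expect-sum-≤ δ (λ i π → minPos π (Sᵢ i)) _ (λ i → ordered (ι i) j (ι≤j i)) ⟩
    fromℕ m ℚ.* expect δ (λ π → minPos π (S j))
      ∎)
  where
  open ≤-Reasoning
  t = toℕ j
  -- j is 0-indexed: the sets up to and including S j are the m = t + 1 sets S₀, …, Sₜ.
  m = suc t
  gauss : m * (t ℕ.+ 2) ≡ tri (suc m) * 2
  gauss = trans (cong (m *_) (ℕ.+-comm t 2)) (sym (tri[1+m]*2≡m*[1+m] m))
  ι : Fin m → Fin k
  ι i = inject≤ i (Fin.toℕ<n j)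
  ι≤j : ∀ i → toℕ (ι i) ℕ.≤ t
  ι≤j i = ℕ.≤-trans (ℕ.≤-reflexive (Fin.toℕ-inject≤ i _)) (ℕ.s≤s⁻¹ (Fin.toℕ<n i))
  Sᵢ : Fin m → Subset n
  Sᵢ = S ∘ ι
  nonempty : ∀ i → Nonempty (Sᵢ i)
  nonempty i = 0<∣p∣⇒Nonempty (Sᵢ i) (subst (0 ℕ.<_) (sym (∣S∣≡r (ι i))) 1≤r)
  disjointᵢ : PairwiseDisjoint Sᵢ
  disjointᵢ = PairwiseDisjoint-∘ (λ {i} {i′} → Fin.inject≤-injective (Fin.toℕ<n j) (Fin.toℕ<n j) i i′) disjoint
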